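{- Let $\mathbb{A}$ be a reduct of a countably infinite homogeneous graph $\mathbb{H}=(A;E)$ preserved by a ternary injection $f:A^3\to A$ of behaviour majority which additionally is hyperplanely balanced and of behaviour projection, or hyperplanely $E$-constant, or hyperplanely $N$-constant, or hyperplanely of behaviour max and $E$-dominated, or hyperplanely of behaviour min and $N$-dominated. Then $\mathbb{A}$ pp-defines no $[(O(x_1,x_2)\Rightarrow x_3=x_4)]$-relation with $O\in\{E,N\}$.
   Context: A countably infinite homogeneous graph is a countably infinite loopless undirected graph $\mathbb{H}=(A;E)$ in which every isomorphism between finite induced subgraphs extends to an automorphism; $N:=\{(a,b):a\ne b,(a,b)\notin E\}$. A reduct of $\mathbb{H}$ is a structure on $A$ with finitely many relations each first-order definable in $\mathbb{H}$. $\mathbb{A}$ is preserved by $f$ if $f$ applied coordinatewise to tuples of any relation of $\mathbb{A}$ gives a tuple of that relation. pp-definable: definable by a formula built from atomic formulas over the signature of $\mathbb{A}$ and equality using only conjunction and existential quantification. For binary relations $R_1,\dots,R_k$ (including $=$, $\neq$) and $a,b\in A^k$ write $R_1\cdots R_k(a,b)$ if $(a[i],b[i])\in R_i$ for all $i$. A ternary injection $f$ is of behaviour majority if for all $a,b\in A^3$ with ${\neq}{\neq}{\neq}(a,b)$: $E(f(a),f(b))$ iff one of $EEE(a,b),EEN(a,b),ENE(a,b),NEE(a,b)$ holds. Binary injection behaviours: balanced: $E{=}(a,b)$ or ${=}E(a,b)$ implies $E(g(a),g(b))$ and $N{=}(a,b)$ or ${=}N(a,b)$ implies $N(g(a),g(b))$;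 $E$-dominated ($N$-dominated): ${\neq}{=}(a,b)$ or ${=}{\neq}(a,b)$ implies $E(g(a),g(b))$ ($N(g(a),g(b))$); min: for ${\neq}{\neq}(a,b)$, $E(g(a),g(b))$ iff $EE(a,b)$; max: for ${\neq}{\neq}(a,b)$, $N(g(a),g(b))$ iff $NN(a,b)$; projection: there is $i\in\{1,2\}$ such that for ${\neq}{\neq}(a,b)$, $E(g(a),g(b))$ iff $E(a[i],b[i])$; $E$-constant ($N$-constant): image is a clique (independent set). $f$ is hyperplanely of a binary behaviour $B$ if for every $c\in A$ the maps $(x,y)\mapsto f(x,y,c)$, $(x,z)\mapsto f(x,c,z)$, $(y,z)\mapsto f(c,y,z)$ have behaviour $B$. A quaternary $R$ is a $[(O(x_1,x_2)\Rightarrow x_3=x_4)]$-relation if every $t\in R$ with $(t[1],t[2])\in O$ has $t[3]=t[4]$, and $R$ contains $t_1$ with $(t_1[1],t_1[2])\in O$, $t_1[3]=t_1[4]$ and $t_2$ with $(t_2[1],t_2[2])\notin O$, $t_2[3]\neq t_2[4]$. -}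

module Defs where

open import Data.Nat using (ℕ; suc)
open import Data.Fin using (Fin; zero; suc)
open import Data.Product using (Σ; ∃; _×_; _,_)
open import Data.Sum using (_⊎_)
open import Data.Empty using (⊥)
open import Data.Unit using (⊤)
open import Data.Vec.Functional using (_∷_)
open import Relation.Nullary using (¬_)
open import Relation.Binary.PropositionalEquality using (_≡_; _≢_)
open import Function.Bundles using (_↔_; _⇔_; Inverse)

module _ {A : Set} (E : A → A → Set) where

  IsLooplessUndirected : Set
  IsLooplessUndirected = (∀ x → ¬ E x x) × (∀ x y → E x y → E y x)

  N : A → A → Set
  N a b = (a ≢ b) × ¬ E a b

  IsAutomorphism : (A ↔ A) → Set
  IsAutomorphism α = ∀ x y → E x y ⇔ E (Inverse.to α x) (Inverse.to α y)

  -- A finite partial isomorphism is given by enumerating its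
  -- domain as an injective tuple a and its values as the injective tuple b.
  IsHomogeneous : Set
  IsHomogeneous =
    ∀ (n : ℕ) (a b : Fin n → A) →
    (∀ i j → a i ≡ a j → i ≡ j) →
    (∀ i j → b i ≡ b j → i ≡ j) →
    (∀ i j → E (a i) (a j) ⇔ E (b i) (b j)) →
    Σ (A ↔ A) λ α → IsAutomorphism α × (∀ i → Inverse.to α (a i) ≡ b i)

data FO : ℕ → Set where
  edge : ∀ {n} → Fin n → Fin n → FO n
  equal : ∀ {n} → Fin n → Fin n → FO n
  falsum : ∀ {n} → FO n
  verum : ∀ {n} → FO n
  neg : ∀ {n} → FO n → FO n
  conj : ∀ {n} → FO n → FO n → FO n
  disj : ∀ {n} → FO n → FO n → FO n
  impl : ∀ {n} → FO n → FO n → FO n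
  all : ∀ {n} → FO (suc n) → FO n
  ex : ∀ {n} → FO (suc n) → FO n

module _ {A : Set} (E : A → A → Set) where

  ⟦_⟧FO : ∀ {n} → FO n → (Fin n → A) → Set
  ⟦ edge i j ⟧FO t = E (t i) (t j)
  ⟦ equal i j ⟧FO t = t i ≡ t j
  ⟦ falsum ⟧FO t = ⊥
  ⟦ verum ⟧FO t = ⊤
  ⟦ neg φ ⟧FO t = ¬ ⟦ φ ⟧FO t
  ⟦ conj φ ψ ⟧FO t = ⟦ φ ⟧FO t × ⟦ ψ ⟧FO t
  ⟦ disj φ ψ ⟧FO t = ⟦ φ ⟧FO t ⊎ ⟦ ψ ⟧FO t
  ⟦ impl φ ψ ⟧FO t = ⟦ φ ⟧FO t → ⟦ ψ ⟧FO t
  ⟦ all φ ⟧FO t = ∀ (a : A) → ⟦ φ ⟧FO (a ∷ t)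
  ⟦ ex φ ⟧FO t = Σ A λ a → ⟦ φ ⟧FO (a ∷ t)

  FODefinable : ∀ {k} → ((Fin k → A) → Set) → Set
  FODefinable {k} R = Σ (FO k) λ φ → ∀ t → R t ⇔ ⟦ φ ⟧FO t

record Structure (A : Set) : Set₁ where
  field
    m : ℕ
    arity : Fin m → ℕ
    rel : (i : Fin m) → (Fin (arity i) → A) → Set

open Structure public

IsReduct : {A : Set} (E : A → A → Set) → Structure A → Set
IsReduct E 𝔸 = ∀ i → FODefinable E (rel 𝔸 i)

data PP {A : Set} (𝔸 : Structure A) : ℕ → Set where
  atom : ∀ {n} (i : Fin (m 𝔸)) → (Fin (arity 𝔸 i) → Fin n) → PP 𝔸 n
  equal : ∀ {n} → Fin n → Fin n → PP 𝔸 n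
  conj : ∀ {n} → PP 𝔸 n → PP 𝔸 n → PP 𝔸 n
  ex : ∀ {n} → PP 𝔸 (suc n) → PP 𝔸 n

⟦_⟧PP : {A : Set} {𝔸 : Structure A} {n : ℕ} → PP 𝔸 n → (Fin n → A) → Set
⟦_⟧PP {𝔸 = 𝔸} (atom i v) t = rel 𝔸 i (λ j → t (v j))
⟦ equal i j ⟧PP t = t i ≡ t j
⟦ conj φ ψ ⟧PP t = ⟦ φ ⟧PP t × ⟦ ψ ⟧PP t
⟦_⟧PP {A = B} (ex φ) t = Σ B λ a → ⟦ φ ⟧PP (a ∷ t)

PPDefinable : {A : Set} (𝔸 : Structure A) {k : ℕ} → ((Fin k → A) → Set) → Set
PPDefinable 𝔸 {k} R = Σ (PP 𝔸 k) λ φ → ∀ t → R t ⇔ ⟦ φ ⟧PP t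

PreservedBy : {A : Set} → Structure A → (A → A → A → A) → Set
PreservedBy {A} 𝔸 f =
  ∀ i (t₁ t₂ t₃ : Fin (arity 𝔸 i) → A) →
  rel 𝔸 i t₁ → rel 𝔸 i t₂ → rel 𝔸 i t₃ →
  rel 𝔸 i (λ j → f (t₁ j) (t₂ j) (t₃ j))

module _ {A : Set} (E : A → A → Set) where

  TernaryInjective : (A → A → A → A) → Set
  TernaryInjective f = ∀ a₁ a₂ a₃ b₁ b₂ b₃ →
    f a₁ a₂ a₃ ≡ f b₁ b₂ b₃ → (a₁ ≡ b₁) × (a₂ ≡ b₂) × (a₃ ≡ b₃)

  Majority : (A → A → A → A) → Set
  Majority f = ∀ a₁ a₂ a₃ b₁ b₂ b₃ →
    a₁ ≢ b₁ → a₂ ≢ b₂ → a₃ ≢ b₃ →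
    E (f a₁ a₂ a₃) (f b₁ b₂ b₃) ⇔
      ((E a₁ b₁ × E a₂ b₂ × E a₃ b₃) ⊎
       (E a₁ b₁ × E a₂ b₂ × N E a₃ b₃) ⊎
       (E a₁ b₁ × N E a₂ b₂ × E a₃ b₃) ⊎
       (N E a₁ b₁ × E a₂ b₂ × E a₃ b₃))

  Balanced : (A → A → A) → Set
  Balanced g = ∀ a₁ a₂ b₁ b₂ →
    (((E a₁ b₁ × a₂ ≡ b₂) ⊎ (a₁ ≡ b₁ × E a₂ b₂)) → E (g a₁ a₂) (g b₁ b₂)) ×
    (((N E a₁ b₁ × a₂ ≡ b₂) ⊎ (a₁ ≡ b₁ × N E a₂ b₂)) → N E (g a₁ a₂) (g b₁ b₂))

  EDominated : (A → A → A) → Set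
  EDominated g = ∀ a₁ a₂ b₁ b₂ →
    ((a₁ ≢ b₁ × a₂ ≡ b₂) ⊎ (a₁ ≡ b₁ × a₂ ≢ b₂)) → E (g a₁ a₂) (g b₁ b₂)

  NDominated : (A → A → A) → Set
  NDominated g = ∀ a₁ a₂ b₁ b₂ →
    ((a₁ ≢ b₁ × a₂ ≡ b₂) ⊎ (a₁ ≡ b₁ × a₂ ≢ b₂)) → N E (g a₁ a₂) (g b₁ b₂)

  Min : (A → A → A) → Set
  Min g = ∀ a₁ a₂ b₁ b₂ → a₁ ≢ b₁ → a₂ ≢ b₂ →
    E (g a₁ a₂) (g b₁ b₂) ⇔ (E a₁ b₁ × E a₂ b₂)

  Max : (A → A → A) → Set
  Max g = ∀ a₁ a₂ b₁ b₂ → a₁ ≢ b₁ → a₂ ≢ b₂ →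
    N E (g a₁ a₂) (g b₁ b₂) ⇔ (N E a₁ b₁ × N E a₂ b₂)

  Projection : (A → A → A) → Set
  Projection g =
    (∀ a₁ a₂ b₁ b₂ → a₁ ≢ b₁ → a₂ ≢ b₂ → E (g a₁ a₂) (g b₁ b₂) ⇔ E a₁ b₁) ⊎
    (∀ a₁ a₂ b₁ b₂ → a₁ ≢ b₁ → a₂ ≢ b₂ → E (g a₁ a₂) (g b₁ b₂) ⇔ E a₂ b₂)

  EConstant : (A → A → A) → Set
  EConstant g = ∀ a₁ a₂ b₁ b₂ → g a₁ a₂ ≢ g b₁ b₂ → E (g a₁ a₂) (g b₁ b₂)

  NConstant : (A → A → A) → Set
  NConstant g = ∀ a₁ a₂ b₁ b₂ → ¬ E (g a₁ a₂) (g b₁ b₂)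

Hyperplanely : {A : Set} → ((A → A → A) → Set) → (A → A → A → A) → Set
Hyperplanely B f = ∀ c →
  B (λ x y → f x y c) × B (λ x z → f x c z) × B (λ y z → f c y z)

x₁ x₂ x₃ x₄ : Fin 4
x₁ = zero
x₂ = suc zero
x₃ = suc (suc zero)
x₄ = suc (suc (suc zero))

IsImplRel : {A : Set} → (A → A → Set) → ((Fin 4 → A) → Set) → Set
IsImplRel {A} O R =
  (∀ t → R t → O (t x₁) (t x₂) → t x₃ ≡ t x₄) ×
  (Σ (Fin 4 → A) λ t₁ → R t₁ × O (t₁ x₁) (t₁ x₂) × t₁ x₃ ≡ t₁ x₄) ×
  (Σ (Fin 4 → A) λ t₂ → R t₂ × ¬ O (t₂ x₁) (t₂ x₂) × t₂ x₃ ≢ t₂ x₄)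

-- Being pp-definable, R is preserved by f.  Take t₁ ∈ R with O(t₁x₁,t₁x₂) and t₂ ∈ R with
-- ¬O(t₂x₁,t₂x₂), t₂x₃ ≠ t₂x₄.  Then u = f(t₁,t₁,t₂) ∈ R has u x₃ ≠ u x₄, so u x₁, u x₂ are
-- distinct and not in O; hence w = f(t₁,t₁,u) ∈ R has w x₃ ≠ w x₄ although majority puts
-- (w x₁, w x₂) into O.
module Submission where

open import Defs
open import Data.Nat using (ℕ)
open import Data.Fin using (Fin)
open import Data.Product using (_×_; _,_; proj₁; proj₂)
open import Data.Sum using (_⊎_; inj₁; inj₂)
open import Data.Vec.Functional using (_∷_)
open import Data.Vec.Functional.Properties using (∷-cong)
open import Relation.Nullary using (¬_)
open import Relation.Binary.PropositionalEquality
  using (_≢_; _≗_; refl; sym; trans; cong₂; subst₂)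
open import Function.Bundles using (_↔_; Equivalence)

edge⇒≢ : {A : Set} {E : A → A → Set} → (∀ x → ¬ E x x) → ∀ {x y} → E x y → x ≢ y
edge⇒≢ loopless {x} e refl = loopless x e

module _ {A : Set} (E : A → A → Set) where

  ⟦⟧FO-cong : ∀ {n} (φ : FO n) {t t′ : Fin n → A} → t ≗ t′ → ⟦_⟧FO E φ t → ⟦_⟧FO E φ t′
  ⟦⟧FO-cong (edge i j)  t≗t′ p = subst₂ E (t≗t′ i) (t≗t′ j) p
  ⟦⟧FO-cong (equal i j) t≗t′ p = trans (sym (t≗t′ i)) (trans p (t≗t′ j))
  ⟦⟧FO-cong falsum      t≗t′ p = p
  ⟦⟧FO-cong verum       t≗t′ p = p
  ⟦⟧FO-cong (neg φ)     t≗t′ p q = p (⟦⟧FO-cong φ (λ j → sym (t≗t′ j)) q)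
  ⟦⟧FO-cong (conj φ ψ)  t≗t′ (p , q) = ⟦⟧FO-cong φ t≗t′ p , ⟦⟧FO-cong ψ t≗t′ q
  ⟦⟧FO-cong (disj φ ψ)  t≗t′ (inj₁ p) = inj₁ (⟦⟧FO-cong φ t≗t′ p)
  ⟦⟧FO-cong (disj φ ψ)  t≗t′ (inj₂ q) = inj₂ (⟦⟧FO-cong ψ t≗t′ q)
  ⟦⟧FO-cong (impl φ ψ)  t≗t′ p q = ⟦⟧FO-cong ψ t≗t′ (p (⟦⟧FO-cong φ (λ j → sym (t≗t′ j)) q))
  ⟦⟧FO-cong (all φ)     t≗t′ p a = ⟦⟧FO-cong φ (∷-cong refl t≗t′) (p a)
  ⟦⟧FO-cong (ex φ)      t≗t′ (a , p) = a , ⟦⟧FO-cong φ (∷-cong refl t≗t′) p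

  fODefinable-resp-≗ : ∀ {k} {R : (Fin k → A) → Set} → FODefinable E R →
                       ∀ {t t′} → t ≗ t′ → R t → R t′
  fODefinable-resp-≗ (φ , R⇔φ) t≗t′ r =
    Equivalence.from (R⇔φ _) (⟦⟧FO-cong φ t≗t′ (Equivalence.to (R⇔φ _) r))

Preserves : {A : Set} → (A → A → A → A) → ∀ {k} → ((Fin k → A) → Set) → Set
Preserves f R = ∀ a b c → R a → R b → R c → R (λ j → f (a j) (b j) (c j))

module _ {A : Set} {𝔸 : Structure A}
         (rel-resp-≗ : ∀ i {t t′} → t ≗ t′ → rel 𝔸 i t → rel 𝔸 i t′) where

  ⟦⟧PP-cong : ∀ {n} (φ : PP 𝔸 n) {t t′ : Fin n → A} → t ≗ t′ → ⟦ φ ⟧PP t → ⟦ φ ⟧PP t′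
  ⟦⟧PP-cong (atom i v)  t≗t′ p = rel-resp-≗ i (λ j → t≗t′ (v j)) p
  ⟦⟧PP-cong (equal i j) t≗t′ p = trans (sym (t≗t′ i)) (trans p (t≗t′ j))
  ⟦⟧PP-cong (conj φ ψ)  t≗t′ (p , q) = ⟦⟧PP-cong φ t≗t′ p , ⟦⟧PP-cong ψ t≗t′ q
  ⟦⟧PP-cong (ex φ)      t≗t′ (a , p) = a , ⟦⟧PP-cong φ (∷-cong refl t≗t′) p

  module _ (f : A → A → A → A) (pres : PreservedBy 𝔸 f) where

    ⟦⟧PP-preserved : ∀ {n} (φ : PP 𝔸 n) → Preserves f ⟦ φ ⟧PP
    ⟦⟧PP-preserved (atom i v)  a b c p q r = pres i _ _ _ p q r
    ⟦⟧PP-preserved (equal i j) a b c p q r =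
      cong₂ (λ x (yz : A × A) → f x (proj₁ yz) (proj₂ yz)) p (cong₂ _,_ q r)
    ⟦⟧PP-preserved (conj φ ψ)  a b c (p , p′) (q , q′) (r , r′) =
      ⟦⟧PP-preserved φ a b c p q r , ⟦⟧PP-preserved ψ a b c p′ q′ r′
    ⟦⟧PP-preserved (ex φ)      a b c (x , p) (y , q) (z , r) =
      f x y z , ⟦⟧PP-cong φ (∷-cong refl (λ _ → refl))
                  (⟦⟧PP-preserved φ (x ∷ a) (y ∷ b) (z ∷ c) p q r)

    pPDefinable-preserved : ∀ {k} {R : (Fin k → A) → Set} → PPDefinable 𝔸 R → Preserves f R
    pPDefinable-preserved (φ , R⇔φ) a b c p q r =
      Equivalence.from (R⇔φ _) (⟦⟧PP-preserved φ a b c (to p) (to q) (to r))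
      where to = λ {t} → Equivalence.to (R⇔φ t)

MajorityOn : {A : Set} → (A → A → A → A) → (A → A → Set) → Set
MajorityOn f O = ∀ {a₁ a₂ a₃ b₁ b₂ b₃} → O a₁ b₁ → O a₂ b₂ → a₃ ≢ b₃ → ¬ O a₃ b₃ →
                 O (f a₁ a₂ a₃) (f b₁ b₂ b₃)

majorityOn-E : {A : Set} {E : A → A → Set} {f : A → A → A → A} →
               (∀ x → ¬ E x x) → Majority E f → MajorityOn f E
majorityOn-E loopless maj {a₁} {a₂} {a₃} {b₁} {b₂} {b₃} e₁ e₂ a₃≢b₃ ¬e₃ =
  Equivalence.from (maj a₁ a₂ a₃ b₁ b₂ b₃ (edge⇒≢ loopless e₁) (edge⇒≢ loopless e₂) a₃≢b₃)
    (inj₂ (inj₁ (e₁ , e₂ , a₃≢b₃ , ¬e₃)))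

module _ {A : Set} (E : A → A → Set) {f : A → A → A → A} (f-inj : TernaryInjective E f) where

  f-injective₁ : ∀ {a₁ a₂ a₃ b₁ b₂ b₃} → a₁ ≢ b₁ → f a₁ a₂ a₃ ≢ f b₁ b₂ b₃
  f-injective₁ a₁≢b₁ eq = a₁≢b₁ (proj₁ (f-inj _ _ _ _ _ _ eq))

  f-injective₃ : ∀ {a₁ a₂ a₃ b₁ b₂ b₃} → a₃ ≢ b₃ → f a₁ a₂ a₃ ≢ f b₁ b₂ b₃
  f-injective₃ a₃≢b₃ eq = a₃≢b₃ (proj₂ (proj₂ (f-inj _ _ _ _ _ _ eq)))

  ¬IsImplRel-of-preserved : ∀ {O R} → (∀ {x y} → O x y → x ≢ y) → MajorityOn f O →
                            Preserves f R → ¬ IsImplRel O R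
  ¬IsImplRel-of-preserved {O} {R} O-irrefl maj pres
    (O⇒x₃≡x₄ , (t₁ , t₁∈R , O-t₁ , _) , (t₂ , t₂∈R , _ , t₂x₃≢t₂x₄)) =
    w-x₃≢x₄ (O⇒x₃≡x₄ w w∈R O-w)
    where
    u w : Fin 4 → A
    u j = f (t₁ j) (t₁ j) (t₂ j)
    w j = f (t₁ j) (t₁ j) (u j)
    u∈R : R u
    u∈R = pres t₁ t₁ t₂ t₁∈R t₁∈R t₂∈R
    w∈R : R w
    w∈R = pres t₁ t₁ u t₁∈R t₁∈R u∈R
    u-x₃≢x₄ : u x₃ ≢ u x₄
    u-x₃≢x₄ = f-injective₃ t₂x₃≢t₂x₄
    w-x₃≢x₄ : w x₃ ≢ w x₄
    w-x₃≢x₄ = f-injective₃ u-x₃≢x₄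
    O-w : O (w x₁) (w x₂)
    O-w = maj O-t₁ O-t₁ (f-injective₁ (O-irrefl O-t₁))
                        (λ O-u → u-x₃≢x₄ (O⇒x₃≡x₄ u u∈R O-u))

  -- Every edge pattern of majority has an edge in the first or second coordinate.
  majorityOn-N : Majority E f → MajorityOn f (N E)
  majorityOn-N maj {a₁} {a₂} {a₃} {b₁} {b₂} {b₃} (a₁≢b₁ , ¬e₁) (a₂≢b₂ , ¬e₂) a₃≢b₃ _ =
    f-injective₁ a₁≢b₁ , λ e → no-edge-pattern (Equivalence.to (maj a₁ a₂ a₃ b₁ b₂ b₃ a₁≢b₁ a₂≢b₂ a₃≢b₃) e)
    where
    no-edge-pattern : ¬ ((E a₁ b₁ × E a₂ b₂ × E a₃ b₃) ⊎ (E a₁ b₁ × E a₂ b₂ × N E a₃ b₃) ⊎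
                         (E a₁ b₁ × N E a₂ b₂ × E a₃ b₃) ⊎ (N E a₁ b₁ × E a₂ b₂ × E a₃ b₃))
    no-edge-pattern (inj₁ (e₁ , _))                = ¬e₁ e₁
    no-edge-pattern (inj₂ (inj₁ (e₁ , _)))         = ¬e₁ e₁
    no-edge-pattern (inj₂ (inj₂ (inj₁ (e₁ , _))))  = ¬e₁ e₁
    no-edge-pattern (inj₂ (inj₂ (inj₂ (_ , e₂ , _)))) = ¬e₂ e₂

mainTheorem12 : (A : Set) (E : A → A → Set) →
    IsLooplessUndirected E →
    A ↔ ℕ →
    IsHomogeneous E →
    (𝔸 : Structure A) → IsReduct E 𝔸 →
    (f : A → A → A → A) → TernaryInjective E f → PreservedBy 𝔸 f →
    Majority E f →
    (Hyperplanely (λ g → Balanced E g × Projection E g) f ⊎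
     Hyperplanely (EConstant E) f ⊎
     Hyperplanely (NConstant E) f ⊎
     Hyperplanely (λ g → Max E g × EDominated E g) f ⊎
     Hyperplanely (λ g → Min E g × NDominated E g) f) →
    (R : (Fin 4 → A) → Set) → PPDefinable 𝔸 R →
    ¬ IsImplRel E R × ¬ IsImplRel (N E) R
mainTheorem12 A E (loopless , _) _ _ 𝔸 reduct f f-inj pres maj _ R R-pp =
    ¬IsImplRel-of-preserved E f-inj (edge⇒≢ loopless) (majorityOn-E loopless maj) R-preserved
  , ¬IsImplRel-of-preserved E f-inj proj₁ (majorityOn-N E f-inj maj) R-preserved
  where
  R-preserved : Preserves f R
  R-preserved = pPDefinable-preserved (λ i → fODefinable-resp-≗ E (reduct i)) f pres R-pp
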